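{- For all $k\geq 0$, Stern's sequence satisfies $$z\prod_{i=0}^{k-1}\left(1+z^{2^i}+z^{2^{i+1}}\right)=\sum_{n=1}^{2^k}s(n)z^n+\sum_{n=1}^{2^k-1}s(2^k-n)z^{n+2^k}.$$
   Context: Stern's sequence is defined by $s(0)=0$, $s(1)=1$, and for $n\ge1$, $s(2n)=s(n)$, $s(2n+1)=s(n)+s(n+1)$. An empty product equals $1$ and an empty sum equals $0$. -}

module Defs where

open import Data.Nat using (ℕ; zero; suc; ⌊_/2⌋) renaming (_+_ to _+ℕ_)
open import Data.Nat.Base using (_%_)
open import Algebra.Bundles using (CommutativeRing)
open import Level using (Level)

-- Stern's diatomic sequence, computed with fuel.
-- sternF f n = s(n) whenever f ≥ n.
-- s(0)=0, s(1)=1, s(2m)=s(m), s(2m+1)=s(m)+s(m+1).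
sternF : ℕ → ℕ → ℕ
sternF zero n = zero
sternF (suc f) zero = zero
sternF (suc f) (suc zero) = suc zero
sternF (suc f) (suc (suc n)) with (suc (suc n)) % 2
... | zero  = sternF f ⌊ suc (suc n) /2⌋
... | suc _ = sternF f ⌊ suc (suc n) /2⌋ +ℕ sternF f (suc ⌊ suc (suc n) /2⌋)

s : ℕ → ℕ
s n = sternF n n

module _ {c ℓ : Level} (R : CommutativeRing c ℓ) where
  open CommutativeRing R using (Carrier; 0#; 1#; _+_; _*_)

  ι : ℕ → Carrier
  ι zero = 0#
  ι (suc n) = 1# + ι n

  pow : Carrier → ℕ → Carrier
  pow z zero = 1#
  pow z (suc n) = z * pow z n

  prodR : ℕ → (ℕ → Carrier) → Carrier
  prodR zero f = 1#
  prodR (suc k) f = prodR k f * f k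

  -- ∑_{n=a}^{a+m-1} f n   (m terms starting at a; empty sum = 0)
  sumFrom : ℕ → ℕ → (ℕ → Carrier) → Carrier
  sumFrom a zero f = 0#
  sumFrom a (suc m) f = f a + sumFrom (suc a) m f

module Submission where

-- Write F_i(z) = 1 + z^(2^i) + z^(2^(i+1)) and P_k(z) = z ∏_{i<k} F_i(z).  Since F_{i+1}(z) = F_i(z²),
--   ∏_{i<k+1} F_i(z) = (1 + z + z²) · ∏_{i<k} F_i(z²),
-- and multiplying a series in z² by 1 + z + z² acts on coefficient sequences
-- exactly as Stern's recurrence: the new coefficient of z^(2j) is the old one
-- of z^j, that of z^(2j+1) is the sum of the old ones of z^j and z^(j+1).
-- Hence the coefficient sequence of P_k is coeff k, the k-th iterate of this
-- Stern step applied to the coefficient sequence of P_0 = z.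

open import Defs
open import Data.Nat using (ℕ; _∸_; _^_) renaming (_+_ to _+ℕ_)
open import Algebra.Bundles using (CommutativeRing)
open import Level using (Level)

module SternCoefficients where
  open import Data.Nat using (zero; suc; _+_; _≤_; _<_; z≤n; s≤s; _%_; ⌊_/2⌋)
  open import Data.Nat.Properties
    using (+-suc; +-comm; +-identityʳ; ≤-refl; ≤-trans; ≤-reflexive; <⇒≤; n≤1+n;
           m≤n⇒m≤1+n; +-∸-assoc; n∸n≡0; m+[n∸m]≡n; m^n>0)
  open import Relation.Binary.PropositionalEquality
    using (_≡_; refl; sym; trans; cong; cong₂; module ≡-Reasoning)
  open ≡-Reasoning

  -- Doubling, defined so that double (suc n) computes to suc (suc (double n)).
  double : ℕ → ℕ
  double zero = zero
  double (suc n) = suc (suc (double n))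

  data EvenOdd : ℕ → Set where
    even : ∀ j → EvenOdd (double j)
    odd  : ∀ j → EvenOdd (suc (double j))

  evenOrOdd : ∀ n → EvenOdd n
  evenOrOdd zero = even zero
  evenOrOdd (suc n) with evenOrOdd n
  ... | even j = odd j
  ... | odd j = even (suc j)

  double≡+ : ∀ n → double n ≡ n + n
  double≡+ zero = refl
  double≡+ (suc n) = cong suc (trans (cong suc (double≡+ n)) (sym (+-suc n n)))

  2^suc≡+ : ∀ k → 2 ^ suc k ≡ 2 ^ k + 2 ^ k
  2^suc≡+ k = cong (2 ^ k +_) (+-identityʳ (2 ^ k))

  2^suc≡double : ∀ k → 2 ^ suc k ≡ double (2 ^ k)
  2^suc≡double k = trans (2^suc≡+ k) (sym (double≡+ (2 ^ k)))

  2^k≡suc[2^k∸1] : ∀ k → 2 ^ k ≡ suc (2 ^ k ∸ 1)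
  2^k≡suc[2^k∸1] k = sym (m+[n∸m]≡n (m^n>0 2 k))

  double-+ : ∀ m n → double (m + n) ≡ double m + double n
  double-+ zero n = refl
  double-+ (suc m) n = cong (λ x → suc (suc x)) (double-+ m n)

  double-∸ : ∀ m n → double (m ∸ n) ≡ double m ∸ double n
  double-∸ m zero = refl
  double-∸ zero (suc n) = refl
  double-∸ (suc m) (suc n) = double-∸ m n

  double∸odd : ∀ {m n} → n < m → double m ∸ suc (double n) ≡ suc (double (m ∸ suc n))
  double∸odd {suc m} {zero} _ = refl
  double∸odd {suc m} {suc n} (s≤s n<m) = double∸odd n<m

  n≤double : ∀ n → n ≤ double n
  n≤double zero = z≤n
  n≤double (suc n) = s≤s (m≤n⇒m≤1+n (n≤double n))

  double-cancel-≤ : ∀ {m n} → double m ≤ double n → m ≤ n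
  double-cancel-≤ {zero} _ = z≤n
  double-cancel-≤ {suc m} {suc n} (s≤s (s≤s p)) = s≤s (double-cancel-≤ p)

  odd≤double⇒< : ∀ {m n} → suc (double m) ≤ double n → m < n
  odd≤double⇒< {zero} {suc n} _ = s≤s z≤n
  odd≤double⇒< {suc m} {suc n} (s≤s (s≤s p)) = s≤s (odd≤double⇒< p)

  double%2 : ∀ j → double j % 2 ≡ 0
  double%2 zero = refl
  double%2 (suc j) = double%2 j

  odd%2 : ∀ j → suc (double j) % 2 ≡ 1
  odd%2 zero = refl
  odd%2 (suc j) = odd%2 j

  ⌊double/2⌋ : ∀ j → ⌊ double j /2⌋ ≡ j
  ⌊double/2⌋ zero = refl
  ⌊double/2⌋ (suc j) = cong suc (⌊double/2⌋ j)

  ⌊odd/2⌋ : ∀ j → ⌊ suc (double j) /2⌋ ≡ j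
  ⌊odd/2⌋ zero = refl
  ⌊odd/2⌋ (suc j) = cong suc (⌊odd/2⌋ j)

  sternF-even : ∀ f j → sternF (suc f) (double (suc j)) ≡ sternF f (suc j)
  sternF-even f j with double (suc j) % 2 | double%2 (suc j)
  ... | .0 | refl = cong (sternF f) (⌊double/2⌋ (suc j))

  sternF-odd : ∀ f j →
    sternF (suc f) (suc (double (suc j))) ≡ sternF f (suc j) + sternF f (suc (suc j))
  sternF-odd f j with suc (double (suc j)) % 2 | odd%2 (suc j)
  ... | .1 | refl rewrite ⌊odd/2⌋ (suc j) = refl

  sternF-stable : ∀ {f g} n → n ≤ f → n ≤ g → sternF f n ≡ sternF g n
  sternF-stable {zero} {zero} zero _ _ = refl
  sternF-stable {zero} {suc g} zero _ _ = refl
  sternF-stable {suc f} {zero} zero _ _ = refl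
  sternF-stable {suc f} {suc g} zero _ _ = refl
  sternF-stable {suc f} {suc g} (suc zero) _ _ = refl
  sternF-stable {suc f} {suc g} (suc (suc n)) (s≤s p) (s≤s q) with evenOrOdd n
  ... | even j = begin
    sternF (suc f) (double (suc j)) ≡⟨ sternF-even f j ⟩
    sternF f (suc j)                ≡⟨ sternF-stable (suc j) (≤-trans j+1≤ p) (≤-trans j+1≤ q) ⟩
    sternF g (suc j)                ≡⟨ sym (sternF-even g j) ⟩
    sternF (suc g) (double (suc j)) ∎
    where j+1≤ = s≤s (n≤double j)
  ... | odd j = begin
    sternF (suc f) (suc (double (suc j)))          ≡⟨ sternF-odd f j ⟩
    sternF f (suc j) + sternF f (suc (suc j))      ≡⟨ cong₂ _+_
      (sternF-stable (suc j) (≤-trans (n≤1+n _) p′) (≤-trans (n≤1+n _) q′))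
      (sternF-stable (suc (suc j)) p′ q′) ⟩
    sternF g (suc j) + sternF g (suc (suc j))      ≡⟨ sym (sternF-odd g j) ⟩
    sternF (suc g) (suc (double (suc j)))          ∎
    where
    j+2≤ = s≤s (s≤s (n≤double j))
    p′ = ≤-trans j+2≤ p
    q′ = ≤-trans j+2≤ q

  s-even : ∀ j → s (double j) ≡ s j
  s-even zero = refl
  s-even (suc j) =
    trans (sternF-even (suc (double j)) j) (sternF-stable (suc j) (s≤s (n≤double j)) ≤-refl)

  s-odd : ∀ j → s (suc (double j)) ≡ s j + s (suc j)
  s-odd zero = refl
  s-odd (suc j) = trans (sternF-odd (suc (suc (double j))) j) (cong₂ _+_
    (sternF-stable (suc j) (s≤s (m≤n⇒m≤1+n (n≤double j))) ≤-refl)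
    (sternF-stable (suc (suc j)) (s≤s (s≤s (n≤double j))) ≤-refl))

  sternStep : (ℕ → ℕ) → ℕ → ℕ
  sternStep a zero = a 0
  sternStep a (suc zero) = a 0 + a 1
  sternStep a (suc (suc n)) = sternStep (λ i → a (suc i)) n

  sternStep-even : ∀ a j → sternStep a (double j) ≡ a j
  sternStep-even a zero = refl
  sternStep-even a (suc j) = sternStep-even (λ i → a (suc i)) j

  sternStep-odd : ∀ a j → sternStep a (suc (double j)) ≡ a j + a (suc j)
  sternStep-odd a zero = refl
  sternStep-odd a (suc j) = sternStep-odd (λ i → a (suc i)) j

  -- coeff k n is the coefficient of z^n in z ∏_{i<k} F_i(z).
  coeff : ℕ → ℕ → ℕ
  coeff zero (suc zero) = 1
  coeff zero _ = 0
  coeff (suc k) = sternStep (coeff k)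

  coeff-zero : ∀ k → coeff k 0 ≡ 0
  coeff-zero zero = refl
  coeff-zero (suc k) = coeff-zero k

  coeff-lower : ∀ k n → n ≤ 2 ^ k → coeff k n ≡ s n
  coeff-lower zero zero _ = refl
  coeff-lower zero (suc zero) _ = refl
  coeff-lower zero (suc (suc n)) (s≤s ())
  coeff-lower (suc k) n n≤ with evenOrOdd n
  ... | even j = begin
    sternStep (coeff k) (double j) ≡⟨ sternStep-even (coeff k) j ⟩
    coeff k j                      ≡⟨ coeff-lower k j (double-cancel-≤ n≤′) ⟩
    s j                            ≡⟨ sym (s-even j) ⟩
    s (double j)                   ∎
    where n≤′ = ≤-trans n≤ (≤-reflexive (2^suc≡double k))
  ... | odd j = begin
    sternStep (coeff k) (suc (double j)) ≡⟨ sternStep-odd (coeff k) j ⟩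
    coeff k j + coeff k (suc j)          ≡⟨ cong₂ _+_ (coeff-lower k j (<⇒≤ j<)) (coeff-lower k (suc j) j<) ⟩
    s j + s (suc j)                      ≡⟨ sym (s-odd j) ⟩
    s (suc (double j))                   ∎
    where j< = odd≤double⇒< (≤-trans n≤ (≤-reflexive (2^suc≡double k)))

  coeff-upper : ∀ k n → n ≤ 2 ^ k → coeff k (n + 2 ^ k) ≡ s (2 ^ k ∸ n)
  coeff-upper zero zero _ = refl
  coeff-upper zero (suc zero) _ = refl
  coeff-upper zero (suc (suc n)) (s≤s ())
  coeff-upper (suc k) n n≤ with evenOrOdd n
  ... | even j = begin
    coeff (suc k) (double j + 2 ^ suc k)  ≡⟨ cong (coeff (suc k)) index ⟩
    sternStep (coeff k) (double (j + B))  ≡⟨ sternStep-even (coeff k) (j + B) ⟩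
    coeff k (j + B)                       ≡⟨ coeff-upper k j (double-cancel-≤ n≤′) ⟩
    s (B ∸ j)                             ≡⟨ sym (s-even (B ∸ j)) ⟩
    s (double (B ∸ j))                    ≡⟨ cong s (trans (double-∸ B j) (cong (_∸ double j) (sym (2^suc≡double k)))) ⟩
    s (2 ^ suc k ∸ double j)              ∎
    where
    B = 2 ^ k
    n≤′ = ≤-trans n≤ (≤-reflexive (2^suc≡double k))
    index : double j + 2 ^ suc k ≡ double (j + B)
    index = trans (cong (double j +_) (2^suc≡double k)) (sym (double-+ j B))
  ... | odd j = begin
    coeff (suc k) (suc (double j) + 2 ^ suc k)     ≡⟨ cong (coeff (suc k)) index ⟩
    sternStep (coeff k) (suc (double (j + B)))     ≡⟨ sternStep-odd (coeff k) (j + B) ⟩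
    coeff k (j + B) + coeff k (suc j + B)          ≡⟨ cong₂ _+_ (coeff-upper k j (<⇒≤ j<)) (coeff-upper k (suc j) j<) ⟩
    s (B ∸ j) + s (B ∸ suc j)                      ≡⟨ cong (λ x → s x + s (B ∸ suc j)) B∸j ⟩
    s (suc (B ∸ suc j)) + s (B ∸ suc j)            ≡⟨ +-comm (s (suc (B ∸ suc j))) _ ⟩
    s (B ∸ suc j) + s (suc (B ∸ suc j))            ≡⟨ sym (s-odd (B ∸ suc j)) ⟩
    s (suc (double (B ∸ suc j)))                   ≡⟨ cong s (sym (double∸odd j<)) ⟩
    s (double B ∸ suc (double j))                  ≡⟨ cong (λ x → s (x ∸ suc (double j))) (sym (2^suc≡double k)) ⟩
    s (2 ^ suc k ∸ suc (double j))                 ∎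
    where
    B = 2 ^ k
    j< = odd≤double⇒< (≤-trans n≤ (≤-reflexive (2^suc≡double k)))
    index : suc (double j) + 2 ^ suc k ≡ suc (double (j + B))
    index = cong suc (trans (cong (double j +_) (2^suc≡double k)) (sym (double-+ j B)))
    B∸j : B ∸ j ≡ suc (B ∸ suc j)
    B∸j = +-∸-assoc 1 j<

  coeff-top : ∀ k → coeff k (2 ^ suc k) ≡ 0
  coeff-top k = begin
    coeff k (2 ^ suc k)     ≡⟨ cong (coeff k) (2^suc≡+ k) ⟩
    coeff k (2 ^ k + 2 ^ k) ≡⟨ coeff-upper k (2 ^ k) ≤-refl ⟩
    s (2 ^ k ∸ 2 ^ k)       ≡⟨ cong s (n∸n≡0 (2 ^ k)) ⟩
    0                       ∎

module PowerSeries {c ℓ : Level} (R : CommutativeRing c ℓ) where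
  open import Data.Nat using (zero; suc; _≤_; _<_; s≤s; z≤n)
  import Data.Nat.Properties as ℕₚ
  import Relation.Binary.PropositionalEquality as ≡
  open import Data.Maybe using (nothing)
  open import Tactic.RingSolver.Core.AlmostCommutativeRing using (AlmostCommutativeRing; fromCommutativeRing)
  open import Tactic.RingSolver using (solve-∀)
  open SternCoefficients

  module Identities where
    R′ : AlmostCommutativeRing c ℓ
    R′ = fromCommutativeRing R (λ _ → nothing)
    open AlmostCommutativeRing R′

    pull-last : ∀ q S x y → q * (S + y) + x ≈ (q * S + x) + q * y
    pull-last = solve-∀ R′

    collect-terms : ∀ S u v p a b → (S + u * p) + ((v * p + a) + b) ≈ ((S + (u + v) * p) + a) + b
    collect-terms = solve-∀ R′

    move-scalar : ∀ z x p → z * (x * p) ≈ x * (z * p)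
    move-scalar = solve-∀ R′

  open Identities
  open CommutativeRing R
  open import Relation.Binary.Reasoning.Setoid setoid

  sumFrom-cong : ∀ a m {f g : ℕ → Carrier} →
    (∀ n → n < a +ℕ m → f n ≈ g n) → sumFrom R a m f ≈ sumFrom R a m g
  sumFrom-cong a zero eq = refl
  sumFrom-cong a (suc m) eq = +-cong
    (eq a (ℕₚ.m<m+n a (s≤s z≤n)))
    (sumFrom-cong (suc a) m (λ n n< → eq n (ℕₚ.≤-trans n< (ℕₚ.≤-reflexive (≡.sym (ℕₚ.+-suc a m))))))

  sumFrom-length : ∀ a {m n} f → m ≡.≡ n → sumFrom R a m f ≈ sumFrom R a n f
  sumFrom-length a f eq = reflexive (≡.cong (λ m → sumFrom R a m f) eq)

  sumFrom-snoc : ∀ a m f → sumFrom R a (suc m) f ≈ sumFrom R a m f + f (a +ℕ m)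
  sumFrom-snoc a zero f = trans (+-comm (f a) 0#) (+-congˡ (reflexive (≡.cong f (≡.sym (ℕₚ.+-identityʳ a)))))
  sumFrom-snoc a (suc m) f = begin
    f a + sumFrom R (suc a) (suc m) f        ≈⟨ +-congˡ (sumFrom-snoc (suc a) m f) ⟩
    f a + (sumFrom R (suc a) m f + f (suc a +ℕ m)) ≈⟨ sym (+-assoc _ _ _) ⟩
    sumFrom R a (suc m) f + f (suc (a +ℕ m))  ≈⟨ +-congˡ (reflexive (≡.cong f (≡.sym (ℕₚ.+-suc a m)))) ⟩
    sumFrom R a (suc m) f + f (a +ℕ suc m)   ∎

  sumFrom-split : ∀ a m n f → sumFrom R a (m +ℕ n) f ≈ sumFrom R a m f + sumFrom R (a +ℕ m) n f
  sumFrom-split a zero n f = begin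
    sumFrom R a n f              ≈⟨ reflexive (≡.cong (λ b → sumFrom R b n f) (≡.sym (ℕₚ.+-identityʳ a))) ⟩
    sumFrom R (a +ℕ 0) n f       ≈⟨ sym (+-identityˡ _) ⟩
    0# + sumFrom R (a +ℕ 0) n f  ∎
  sumFrom-split a (suc m) n f = begin
    f a + sumFrom R (suc a) (m +ℕ n) f ≈⟨ +-congˡ (sumFrom-split (suc a) m n f) ⟩
    f a + (sumFrom R (suc a) m f + sumFrom R (suc a +ℕ m) n f) ≈⟨ sym (+-assoc _ _ _) ⟩
    sumFrom R a (suc m) f + sumFrom R (suc (a +ℕ m)) n f ≈⟨ +-congˡ (reflexive (≡.cong (λ b → sumFrom R b n f) (≡.sym (ℕₚ.+-suc a m)))) ⟩
    sumFrom R a (suc m) f + sumFrom R (a +ℕ suc m) n f ∎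

  sumFrom-shift : ∀ a d m f → sumFrom R (a +ℕ d) m f ≈ sumFrom R a m (λ n → f (n +ℕ d))
  sumFrom-shift a d zero f = refl
  sumFrom-shift a d (suc m) f = +-congˡ (sumFrom-shift (suc a) d m f)

  sumFrom-scale : ∀ x a m f → x * sumFrom R a m f ≈ sumFrom R a m (λ n → x * f n)
  sumFrom-scale x a zero f = zeroʳ x
  sumFrom-scale x a (suc m) f = trans (distribˡ x _ _) (+-congˡ (sumFrom-scale x (suc a) m f))

  ι-+ : ∀ m n → ι R (m +ℕ n) ≈ ι R m + ι R n
  ι-+ zero n = sym (+-identityˡ _)
  ι-+ (suc m) n = trans (+-congˡ (ι-+ m n)) (sym (+-assoc _ _ _))

  pow-square : ∀ z n → pow R (z * z) n ≈ pow R z (double n)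
  pow-square z zero = refl
  pow-square z (suc n) = trans (*-congˡ (pow-square z n)) (*-assoc z z _)

  pow-2^suc : ∀ z i → pow R z (2 ^ suc i) ≈ pow R (z * z) (2 ^ i)
  pow-2^suc z i = trans (reflexive (≡.cong (pow R z) (2^suc≡double i))) (sym (pow-square z (2 ^ i)))

  prodR-front : ∀ k f → prodR R (suc k) f ≈ f 0 * prodR R k (λ i → f (suc i))
  prodR-front zero f = *-comm 1# (f 0)
  prodR-front (suc k) f = trans (*-congʳ (prodR-front k f)) (*-assoc _ _ _)

  prodR-cong : ∀ k {f g : ℕ → Carrier} → (∀ i → f i ≈ g i) → prodR R k f ≈ prodR R k g
  prodR-cong zero eq = refl
  prodR-cong (suc k) eq = *-cong (prodR-cong k eq) (eq k)

  factor : Carrier → ℕ → Carrier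
  factor z i = (1# + pow R z (2 ^ i)) + pow R z (2 ^ (i +ℕ 1))

  quadratic : Carrier → Carrier
  quadratic z = 1# + z + z * z

  factor-zero : ∀ z → factor z 0 ≈ quadratic z
  factor-zero z = +-cong (+-congˡ (*-identityʳ z)) (*-congˡ (*-identityʳ z))

  factor-suc : ∀ z i → factor z (suc i) ≈ factor (z * z) i
  factor-suc z i = +-cong (+-congˡ (pow-2^suc z i)) (pow-2^suc z (i +ℕ 1))

  quadratic-distrib : ∀ z x → quadratic z * x ≈ (x + z * x) + (z * z) * x
  quadratic-distrib z x = trans (distribʳ x (1# + z) (z * z))
    (+-congʳ (trans (distribʳ x 1# z) (+-congʳ (*-identityˡ x))))

  -- Multiplying a series in z² by 1 + z + z² applies the Stern step to its
  -- coefficient sequence b.  The constant term of b and the top term of the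
  -- product are kept explicit, which makes the identity hold for every L.
  stern-step-series : ∀ z (b : ℕ → ℕ) L →
    quadratic z * sumFrom R 0 L (λ n → ι R (b (suc n)) * pow R z (double n)) + ι R (b 0)
    ≈ sumFrom R 0 (double L) (λ m → ι R (sternStep b (suc m)) * pow R z m)
      + ι R (b L) * pow R z (double L)
  stern-step-series z b zero = begin
    quadratic z * 0# + ι R (b 0) ≈⟨ trans (+-congʳ (zeroʳ _)) (+-identityˡ _) ⟩
    ι R (b 0)                    ≈⟨ sym (trans (+-identityˡ _) (*-identityʳ _)) ⟩
    0# + ι R (b 0) * 1#          ∎
  stern-step-series z b (suc L) = begin
    Q * sumFrom R 0 (suc L) f + ι R (b 0)
      ≈⟨ +-congʳ (*-congˡ (sumFrom-snoc 0 L f)) ⟩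
    Q * (sumFrom R 0 L f + v * p) + ι R (b 0)
      ≈⟨ pull-last Q _ _ _ ⟩
    (Q * sumFrom R 0 L f + ι R (b 0)) + Q * (v * p)
      ≈⟨ +-cong (stern-step-series z b L) (quadratic-distrib z (v * p)) ⟩
    (G + u * p) + ((v * p + z * (v * p)) + (z * z) * (v * p))
      ≈⟨ +-congˡ (+-cong (+-congˡ (move-scalar z v p)) z²-term) ⟩
    (G + u * p) + ((v * p + v * (z * p)) + v * (z * (z * p)))
      ≈⟨ collect-terms G u v p _ _ ⟩
    ((G + (u + v) * p) + v * (z * p)) + v * (z * (z * p))
      ≈⟨ +-congʳ (+-cong (+-congˡ (*-congʳ odd-coefficient)) (*-congʳ even-coefficient)) ⟩
    ((G + g (double L)) + g (suc (double L))) + v * (z * (z * p))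
      ≈⟨ +-congʳ (sym (trans (sumFrom-snoc 0 (suc (double L)) g) (+-congʳ (sumFrom-snoc 0 (double L) g)))) ⟩
    sumFrom R 0 (double (suc L)) g + v * (z * (z * p)) ∎
    where
    Q = quadratic z
    f = λ n → ι R (b (suc n)) * pow R z (double n)
    g = λ m → ι R (sternStep b (suc m)) * pow R z m
    G = sumFrom R 0 (double L) g
    p = pow R z (double L)
    u = ι R (b L)
    v = ι R (b (suc L))
    z²-term : (z * z) * (v * p) ≈ v * (z * (z * p))
    z²-term = trans (*-assoc z z _) (trans (*-congˡ (move-scalar z v p)) (move-scalar z v _))
    odd-coefficient : u + v ≈ ι R (sternStep b (suc (double L)))
    odd-coefficient = sym (trans (reflexive (≡.cong (ι R) (sternStep-odd b L))) (ι-+ (b L) (b (suc L))))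
    even-coefficient : v ≈ ι R (sternStep b (double (suc L)))
    even-coefficient = sym (reflexive (≡.cong (ι R) (sternStep-even b (suc L))))

  expansionTerm : ℕ → Carrier → ℕ → Carrier
  expansionTerm k z n = ι R (coeff k (suc n)) * pow R z n

  product-expansion : ∀ k z → prodR R k (factor z) ≈ sumFrom R 0 (2 ^ suc k) (expansionTerm k z)
  product-expansion zero z = begin
    1#                                       ≈⟨ sym (*-identityʳ 1#) ⟩
    1# * 1#                                  ≈⟨ *-congʳ (sym (+-identityʳ 1#)) ⟩
    (1# + 0#) * 1#                           ≈⟨ sym (+-identityʳ _) ⟩
    (1# + 0#) * 1# + 0#                      ≈⟨ +-congˡ (sym (trans (+-congʳ (zeroˡ _)) (+-identityˡ 0#))) ⟩
    (1# + 0#) * 1# + (0# * (z * 1#) + 0#)    ∎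
  product-expansion (suc k) z = begin
    prodR R (suc k) (factor z)
      ≈⟨ prodR-front k (factor z) ⟩
    factor z 0 * prodR R k (λ i → factor z (suc i))
      ≈⟨ *-cong (factor-zero z) (prodR-cong k (factor-suc z)) ⟩
    Q * prodR R k (factor (z * z))
      ≈⟨ *-congˡ (product-expansion k (z * z)) ⟩
    Q * sumFrom R 0 L (expansionTerm k (z * z))
      ≈⟨ *-congˡ (sumFrom-cong 0 L (λ n _ → *-congˡ (pow-square z n))) ⟩
    Q * sumFrom R 0 L f
      ≈⟨ sym (trans (+-congˡ (reflexive (≡.cong (ι R) (coeff-zero k)))) (+-identityʳ _)) ⟩
    Q * sumFrom R 0 L f + ι R (coeff k 0)
      ≈⟨ stern-step-series z (coeff k) L ⟩
    sumFrom R 0 (double L) (expansionTerm (suc k) z) + ι R (coeff k L) * pow R z (double L)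
      ≈⟨ trans (+-congˡ (trans (*-congʳ (reflexive (≡.cong (ι R) (coeff-top k)))) (zeroˡ _))) (+-identityʳ _) ⟩
    sumFrom R 0 (double L) (expansionTerm (suc k) z)
      ≈⟨ sumFrom-length 0 _ (≡.sym (2^suc≡double (suc k))) ⟩
    sumFrom R 0 (2 ^ suc (suc k)) (expansionTerm (suc k) z) ∎
    where
    Q = quadratic z
    L = 2 ^ suc k
    f = λ n → ι R (coeff k (suc n)) * pow R z (double n)

  coeffTerm : ℕ → Carrier → ℕ → Carrier
  coeffTerm k z n = ι R (coeff k n) * pow R z n

  shifted-expansion : ∀ k z →
    z * prodR R k (factor z) ≈ sumFrom R 1 (2 ^ suc k) (coeffTerm k z)
  shifted-expansion k z = begin
    z * prodR R k (factor z)                        ≈⟨ *-congˡ (product-expansion k z) ⟩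
    z * sumFrom R 0 N (expansionTerm k z)           ≈⟨ sumFrom-scale z 0 N _ ⟩
    sumFrom R 0 N (λ n → z * expansionTerm k z n)   ≈⟨ sumFrom-cong 0 N (λ n _ → raise n) ⟩
    sumFrom R 0 N (λ n → coeffTerm k z (n +ℕ 1))    ≈⟨ sym (sumFrom-shift 0 1 N _) ⟩
    sumFrom R 1 N (coeffTerm k z)                   ∎
    where
    N = 2 ^ suc k
    raise : ∀ n → z * expansionTerm k z n ≈ coeffTerm k z (n +ℕ 1)
    raise n = trans (move-scalar z _ _) (reflexive (≡.cong (coeffTerm k z) (ℕₚ.+-comm 1 n)))

  -- The theorem: split the shifted expansion at 2^k and read off the
  -- coefficients on each half; the term z^(2^(k+1)) vanishes.
  stern-generating-identity : ∀ z k →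
    z * prodR R k (factor z)
    ≈ sumFrom R 1 (2 ^ k) (λ n → ι R (s n) * pow R z n)
      + sumFrom R 1 (2 ^ k ∸ 1) (λ n → ι R (s (2 ^ k ∸ n)) * pow R z (n +ℕ 2 ^ k))
  stern-generating-identity z k = begin
    z * prodR R k (factor z)                     ≈⟨ shifted-expansion k z ⟩
    sumFrom R 1 (2 ^ suc k) term                 ≈⟨ sumFrom-length 1 term (2^suc≡+ k) ⟩
    sumFrom R 1 (B +ℕ B) term                    ≈⟨ sumFrom-split 1 B B term ⟩
    sumFrom R 1 B term + sumFrom R (1 +ℕ B) B term ≈⟨ +-cong lower-half upper-half ⟩
    sumFrom R 1 B lowerTerm + sumFrom R 1 M upperTerm ∎
    where
    B = 2 ^ k
    M = B ∸ 1
    term = coeffTerm k z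
    lowerTerm = λ n → ι R (s n) * pow R z n
    upperTerm = λ n → ι R (s (B ∸ n)) * pow R z (n +ℕ B)

    lower-half : sumFrom R 1 B term ≈ sumFrom R 1 B lowerTerm
    lower-half = sumFrom-cong 1 B λ n n< →
      *-congʳ (reflexive (≡.cong (ι R) (coeff-lower k n (ℕₚ.≤-pred n<))))

    last-term-vanishes : term (1 +ℕ B +ℕ M) ≈ 0#
    last-term-vanishes = trans (*-congʳ (reflexive (≡.cong (ι R) coeff≡0))) (zeroˡ _)
      where
      index : 1 +ℕ B +ℕ M ≡.≡ 2 ^ suc k
      index = ≡.trans (≡.sym (ℕₚ.+-suc B M))
                (≡.trans (≡.cong (B +ℕ_) (≡.sym (2^k≡suc[2^k∸1] k))) (≡.sym (2^suc≡+ k)))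
      coeff≡0 : coeff k (1 +ℕ B +ℕ M) ≡.≡ 0
      coeff≡0 = ≡.trans (≡.cong (coeff k) index) (coeff-top k)

    upper-half : sumFrom R (1 +ℕ B) B term ≈ sumFrom R 1 M upperTerm
    upper-half = begin
      sumFrom R (1 +ℕ B) B term                   ≈⟨ sumFrom-length (1 +ℕ B) term (2^k≡suc[2^k∸1] k) ⟩
      sumFrom R (1 +ℕ B) (suc M) term             ≈⟨ sumFrom-snoc (1 +ℕ B) M term ⟩
      sumFrom R (1 +ℕ B) M term + term (1 +ℕ B +ℕ M) ≈⟨ trans (+-congˡ last-term-vanishes) (+-identityʳ _) ⟩
      sumFrom R (1 +ℕ B) M term                   ≈⟨ sumFrom-shift 1 B M term ⟩
      sumFrom R 1 M (λ n → term (n +ℕ B))         ≈⟨ sumFrom-cong 1 M (λ n n< →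
                                                      *-congʳ (reflexive (≡.cong (ι R) (coeff-upper k n (n≤B n n<))))) ⟩
      sumFrom R 1 M upperTerm                     ∎
      where
      n≤B : ∀ n → n < 1 +ℕ M → n ≤ B
      n≤B n n< = ℕₚ.≤-trans (ℕₚ.≤-pred n<) (ℕₚ.m∸n≤m B 1)

open CommutativeRing using (Carrier; _≈_; _+_; _*_; 1#)

lemma3p1 : {c ℓ : Level} (R : CommutativeRing c ℓ) (z : Carrier R) (k : ℕ) →
    _≈_ R
      (_*_ R z (prodR R k (λ i → _+_ R (_+_ R (1# R) (pow R z (2 ^ i))) (pow R z (2 ^ (i +ℕ 1))))))
      (_+_ R
        (sumFrom R 1 (2 ^ k) (λ n → _*_ R (ι R (s n)) (pow R z n)))
        (sumFrom R 1 (2 ^ k ∸ 1) (λ n → _*_ R (ι R (s (2 ^ k ∸ n))) (pow R z (n +ℕ 2 ^ k)))))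
lemma3p1 R z k = PowerSeries.stern-generating-identity R z k
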